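{- Let $p\geq 3$ be prime and $u\in\{1,\ldots ,p-1\}$. Let $n\geq p$ be of the form $n=n''p^{s+1}+kp^{s}+j$ for some $n''\in\mathbb{N}$, $k\in\{1, \ldots, p-1\}$, $s\in\mathbb{N}_{+}$ and $j\in\{0,\ldots, p-1\}$. Then $$ \nu_{p}\left(\sum_{i=0}^{u}(-1)^{i}\binom{u}{i}D_{p}(n-i)\right)=\nu_{p}\left((p-k)\binom{p+u-1}{j}+k\binom{p+u-1}{p+j}\right). $$ In particular: (a) If $u=1$, then $\nu_{p}\left(\sum_{i=0}^{1}(-1)^{i}\binom{1}{i}D_{p}(n-i)\right)=\nu_{p}(D_{p}(n)-D_{p}(n-1))=1$ for any $n\in\mathbb{N}_{+}$. (b) If $j\geq u$, then $\nu_{p}\left(\sum_{i=0}^{u}(-1)^{i}\binom{u}{i}D_{p}(n-i)\right)=1$. (c) If $u\geq 2$, then there exist $j, k\in\{0,\ldots,p-1\}$, $k\neq 0$, such that for $n=n''p^{s+1}+kp^{s}+j$ we have $\nu_{p}\left(\sum_{i=0}^{u}(-1)^{i}\binom{u}{i}D_{p}(n-i)\right)\geq 2$.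
   Context: $\mathbb{N}$ denotes the nonnegative integers, $\mathbb{N}_{+}$ the positive integers, and $\nu_p(n)$ is the $p$-adic valuation of $n$ (with $\nu_p(0)=+\infty$). For $i\in\{0,\ldots,p-1\}$ and $n\in\mathbb{N}$, $N_p(i,n)$ denotes the number of digits equal to $i$ in the base-$p$ representation of $n$. For an odd prime $p$, $D_p(n)$ is defined as $D_{p}(n)=\prod_{i=0}^{p-1}(-1)^{iN_{p}(i,n)}\binom{p-1}{i}^{N_{p}(i,n)}$; equivalently, $D_p(n)$ is the coefficient of $x^n$ in $\prod_{m=0}^{\infty}(1-x^{p^{m}})^{p-1}=\sum_{n=0}^{\infty}D_p(n)x^n$. It satisfies $D_p(pn+j)=(-1)^j\binom{p-1}{j}D_p(n)$ for $j\in\{0,\ldots,p-1\}$, and $D_p(n)\neq 0$ for all $n$. -}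

module Defs where

open import Data.Nat using (ℕ; zero; suc; _∸_; _^_)
open import Data.Nat.Divisibility using (_∣_)
open import Data.Nat.DivMod using (_%_; _/_)
open import Data.Nat.Combinatorics using (_C_)
open import Data.Integer using (ℤ; +_; -_; _*_; _+_)
open import Data.Product using (_×_)
open import Relation.Nullary using (¬_)

sgn : ℕ → ℤ
sgn zero    = + 1
sgn (suc i) = - sgn i

-- With fuel ≥ number of digits the
-- result is the digit product of the paper (leading zero digits give
-- factor 1).  For p = 0 the value is irrelevant (p is always prime).
Dfuel : ℕ → ℕ → ℕ → ℤ
Dfuel zero    _        _ = + 1
Dfuel (suc q) zero     _ = + 1
Dfuel (suc q) (suc f)  n =
  (sgn (n % suc q) * (+ (q C (n % suc q)))) * Dfuel (suc q) f (n / suc q)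

-- D_p(n); n steps of fuel suffice since n has at most n base-p digits (p ≥ 2).
D : ℕ → ℕ → ℤ
D p n = Dfuel p n n

sumTo : (ℕ → ℤ) → ℕ → ℤ
sumTo f zero    = f 0
sumTo f (suc m) = sumTo f m + f (suc m)

altSum : ℕ → ℕ → ℕ → ℤ
altSum p u n = sumTo (λ i → (sgn i * (+ (u C i))) * D p (n ∸ i)) u

-- IsVal p x v  :⇔  ν_p(x) = v  (for x = 0, ν_p = ∞ and no v satisfies this)
IsVal : ℕ → ℕ → ℕ → Set
IsVal p x v = (p ^ v ∣ x) × ¬ (p ^ suc v ∣ x)

{-# OPTIONS --safe #-}
-- Write n = j + M·p.  In the alternating sum, the terms with i ≤ j only lower the last
-- base-p digit of n, while those with i > j borrow from M, so the digit recursion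
-- D_p(pm + d) = (-1)^d C(p-1,d) D_p(m) splits the sum into two Vandermonde convolutions:
--   ± D_p(M) C(p+u-1, j) ± D_p(M-1) C(p+u-1, p+j).
-- For M = p^(s-1)(k + n″p), trailing zero digits are invisible to D_p and so are trailing
-- digits p-1 (as p-1 is even), giving D_p(M) = ±C(p-1,k) D_p(n″) and
-- D_p(M-1) = ±C(p-1,k-1) D_p(n″).  With k C(p-1,k) = (p-k) C(p-1,k-1) this yields
--   k·|Σ| = |D_p(n″)| C(p-1,k-1) ((p-k) C(p+u-1,j) + k C(p+u-1,p+j)),
-- where every factor other than the last is prime to p.  Part (a) is the same computation
-- for a single step once the trailing zero digits of n are stripped.  The remaining cases
-- follow from ν_p C(p+m,j) = 1 for m < j < p and C(p+m,p) ≡ 1 (mod p); in (c), k is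
-- obtained by solving a linear congruence modulo p.

module Submission where

open import Defs
open import Data.Nat using (ℕ; zero; suc; _+_; _*_; _∸_; _^_; _≤_; _<_; s≤s; z≤n; s≤s⁻¹; NonZero; _!)
open import Data.Nat.Properties
open import Algebra.Properties.CommutativeSemigroup *-commutativeSemigroup using (x∙yz≈y∙xz)
open import Data.Nat.DivMod
open import Data.Nat.Divisibility
open import Data.Nat.Combinatorics using (_C_; nCk+nC[k+1]≡[n+1]C[k+1]; nC1≡n; nCn≡1; k>n⇒nCk≡0; nCk≡n!/k![n-k]!; k![n∸k]!∣n!)
open import Data.Nat.Primality using (Prime; euclidsLemma; prime⇒irreducible)
open import Data.Nat.Coprimality using (Coprime; coprime-Bézout)
open import Data.Nat.GCD using (module Bézout)
open import Data.Nat.Induction using (<-rec)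
open import Data.Integer as ℤ using (ℤ; +_; -_; ∣_∣)
import Data.Integer.Properties as ℤ
open import Data.Product using (_×_; _,_; proj₁; Σ-syntax; ∃₂)
open import Data.Sum using (inj₁; inj₂; [_,_])
open import Data.Empty using (⊥-elim)
open import Function using (_∘_; id)
open import Function.Bundles using (_⇔_; mk⇔; Equivalence)
open import Function.Construct.Identity using (⇔-id)
open import Function.Construct.Composition using (_⇔-∘_)
open import Function.Construct.Symmetry using (⇔-sym)
open import Relation.Nullary using (¬_; yes; no)
open import Relation.Binary.PropositionalEquality using (_≡_; refl; sym; trans; cong; cong₂; subst; subst₂; module ≡-Reasoning)
import Data.Nat.Tactic.RingSolver as ℕ-Solver
import Data.Integer.Tactic.RingSolver as ℤ-Solver

sgn-+ : ∀ m n → sgn (m + n) ≡ sgn m ℤ.* sgn n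
sgn-+ zero    n = sym (ℤ.*-identityˡ (sgn n))
sgn-+ (suc m) n = trans (cong -_ (sgn-+ m n)) (ℤ.neg-distribˡ-* (sgn m) (sgn n))

sgn-∸ : ∀ {i n} → i ≤ n → sgn i ℤ.* sgn (n ∸ i) ≡ sgn n
sgn-∸ {i} {n} i≤n = trans (sym (sgn-+ i (n ∸ i))) (cong sgn (m+[n∸m]≡n i≤n))

∣sgn∣≡1 : ∀ n → ∣ sgn n ∣ ≡ 1
∣sgn∣≡1 zero    = refl
∣sgn∣≡1 (suc n) = trans (ℤ.∣-i∣≡∣i∣ (sgn n)) (∣sgn∣≡1 n)

∣sgn*i∣≡∣i∣ : ∀ n i → ∣ sgn n ℤ.* i ∣ ≡ ∣ i ∣
∣sgn*i∣≡∣i∣ n i = trans (ℤ.abs-* (sgn n) i) (trans (cong (_* ∣ i ∣) (∣sgn∣≡1 n)) (*-identityˡ ∣ i ∣))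

sgn[n*2]≡1 : ∀ n → sgn (n * 2) ≡ + 1
sgn[n*2]≡1 zero    = refl
sgn[n*2]≡1 (suc n) = trans (ℤ.neg-involutive (sgn (n * 2))) (sgn[n*2]≡1 n)

sumToℕ : (ℕ → ℕ) → ℕ → ℕ
sumToℕ f zero    = f 0
sumToℕ f (suc m) = sumToℕ f m + f (suc m)

sumToℕ-cong : ∀ {f g} u → (∀ i → i ≤ u → f i ≡ g i) → sumToℕ f u ≡ sumToℕ g u
sumToℕ-cong zero    f≗g = f≗g 0 z≤n
sumToℕ-cong (suc u) f≗g =
  cong₂ _+_ (sumToℕ-cong u (λ i i≤u → f≗g i (m≤n⇒m≤1+n i≤u))) (f≗g (suc u) ≤-refl)

sumToℕ-zero : ∀ u → sumToℕ (λ _ → 0) u ≡ 0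
sumToℕ-zero zero    = refl
sumToℕ-zero (suc u) = cong (_+ 0) (sumToℕ-zero u)

sumToℕ-+ : ∀ f g u → sumToℕ (λ i → f i + g i) u ≡ sumToℕ f u + sumToℕ g u
sumToℕ-+ f g zero    = refl
sumToℕ-+ f g (suc u) =
  trans (cong (_+ (f (suc u) + g (suc u))) (sumToℕ-+ f g u))
        (+-+-interchange (sumToℕ f u) (sumToℕ g u) (f (suc u)) (g (suc u)))
  where
  +-+-interchange : ∀ a b c d → a + b + (c + d) ≡ a + c + (b + d)
  +-+-interchange = ℕ-Solver.solve-∀

sumToℕ-unfoldˡ : ∀ f u → sumToℕ f (suc u) ≡ f 0 + sumToℕ (λ i → f (suc i)) u
sumToℕ-unfoldˡ f zero    = refl
sumToℕ-unfoldˡ f (suc u) =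
  trans (cong (_+ f (suc (suc u))) (sumToℕ-unfoldˡ f u)) (+-assoc (f 0) _ _)

sumTo-cong : ∀ {f g} u → (∀ i → i ≤ u → f i ≡ g i) → sumTo f u ≡ sumTo g u
sumTo-cong zero    f≗g = f≗g 0 z≤n
sumTo-cong (suc u) f≗g =
  cong₂ ℤ._+_ (sumTo-cong u (λ i i≤u → f≗g i (m≤n⇒m≤1+n i≤u))) (f≗g (suc u) ≤-refl)

sumTo-linear : ∀ a b f g u →
  sumTo (λ i → a ℤ.* f i ℤ.+ b ℤ.* g i) u ≡ a ℤ.* sumTo f u ℤ.+ b ℤ.* sumTo g u
sumTo-linear a b f g zero    = refl
sumTo-linear a b f g (suc u) =
  trans (cong (ℤ._+ (a ℤ.* f (suc u) ℤ.+ b ℤ.* g (suc u))) (sumTo-linear a b f g u))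
        (distrib a b (sumTo f u) (sumTo g u) (f (suc u)) (g (suc u)))
  where
  distrib : ∀ a b x y z w →
    a ℤ.* x ℤ.+ b ℤ.* y ℤ.+ (a ℤ.* z ℤ.+ b ℤ.* w) ≡ a ℤ.* (x ℤ.+ z) ℤ.+ b ℤ.* (y ℤ.+ w)
  distrib = ℤ-Solver.solve-∀

sumTo-pos : ∀ f u → sumTo (λ i → + f i) u ≡ + sumToℕ f u
sumTo-pos f zero    = refl
sumTo-pos f (suc u) =
  trans (cong (ℤ._+ + f (suc u)) (sumTo-pos f u)) (sym (ℤ.pos-+ (sumToℕ f u) (f (suc u))))

-- a C (J − i) for i ≤ J and 0 for i > J, where a C (J ∸ i) would be a C 0 = 1
C∸ : ℕ → ℕ → ℕ → ℕ
C∸ a J       zero    = a C J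
C∸ a zero    (suc i) = 0
C∸ a (suc J) (suc i) = C∸ a J i

C∸-≤ : ∀ a {J i} → i ≤ J → C∸ a J i ≡ a C (J ∸ i)
C∸-≤ a {J}     {zero}  _         = refl
C∸-≤ a {suc J} {suc i} (s≤s i≤J) = C∸-≤ a i≤J

C∸-> : ∀ a {J i} → J < i → C∸ a J i ≡ 0
C∸-> a {zero}  {suc i} _         = refl
C∸-> a {suc J} {suc i} (s≤s J<i) = C∸-> a J<i

pascal : ∀ n k → suc n C suc k ≡ n C k + n C suc k
pascal n k = sym (nCk+nC[k+1]≡[n+1]C[k+1] n k)

vandermonde : ∀ a u J → sumToℕ (λ i → (u C i) * C∸ a J i) u ≡ (a + u) C J
vandermonde a zero    J = trans (*-identityˡ (a C J)) (cong (_C J) (sym (+-identityʳ a)))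
vandermonde a (suc u) J = begin
  sumToℕ (λ i → (suc u C i) * C∸ a J i) (suc u)
    ≡⟨ sumToℕ-unfoldˡ _ u ⟩
  C∸ a J 0 + 0 + sumToℕ (λ i → (suc u C suc i) * C∸ a J (suc i)) u
    ≡⟨ cong (λ s → C∸ a J 0 + 0 + s) (sumToℕ-cong u λ i _ → cong (_* C∸ a J (suc i)) (pascal u i)) ⟩
  C∸ a J 0 + 0 + sumToℕ (λ i → (u C i + u C suc i) * C∸ a J (suc i)) u
    ≡⟨ cong (λ s → C∸ a J 0 + 0 + s) (trans (sumToℕ-cong u λ i _ → *-distribʳ-+ (C∸ a J (suc i)) (u C i) (u C suc i))
                                     (sumToℕ-+ _ _ u)) ⟩
  C∸ a J 0 + 0 + (shifted + sumToℕ (λ i → (u C suc i) * C∸ a J (suc i)) u)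
    ≡⟨ x+[y+z]≡y+[x+z] (C∸ a J 0 + 0) shifted _ ⟩
  shifted + (C∸ a J 0 + 0 + sumToℕ (λ i → (u C suc i) * C∸ a J (suc i)) u)
    ≡⟨ cong (λ s → shifted + s) (sumToℕ-unfoldˡ (λ i → (u C i) * C∸ a J i) u) ⟨
  shifted + sumToℕ (λ i → (u C i) * C∸ a J i) (suc u)
    ≡⟨ cong₂ _+_ refl (trans (cong (λ s → sumToℕ (λ i → (u C i) * C∸ a J i) u + s)
                                   (cong (_* C∸ a J (suc u)) (k>n⇒nCk≡0 (n<1+n u))))
                             (+-identityʳ _)) ⟩
  shifted + sumToℕ (λ i → (u C i) * C∸ a J i) u
    ≡⟨ cong (λ s → shifted + s) (vandermonde a u J) ⟩
  shifted + (a + u) C J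
    ≡⟨ shifted+ J ⟩
  (a + suc u) C J
    ∎
  where
  open ≡-Reasoning
  shifted : ℕ
  shifted = sumToℕ (λ i → (u C i) * C∸ a J (suc i)) u
  x+[y+z]≡y+[x+z] : ∀ x y z → x + (y + z) ≡ y + (x + z)
  x+[y+z]≡y+[x+z] = ℕ-Solver.solve-∀
  shifted+ : ∀ J → sumToℕ (λ i → (u C i) * C∸ a J (suc i)) u + (a + u) C J ≡ (a + suc u) C J
  shifted+ zero    = cong (_+ 1) (trans (sumToℕ-cong u (λ i _ → *-zeroʳ (u C i))) (sumToℕ-zero u))
  shifted+ (suc J) = begin
    sumToℕ (λ i → (u C i) * C∸ a J i) u + (a + u) C suc J ≡⟨ cong (_+ (a + u) C suc J) (vandermonde a u J) ⟩
    (a + u) C J + (a + u) C suc J                        ≡⟨ nCk+nC[k+1]≡[n+1]C[k+1] (a + u) J ⟩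
    suc (a + u) C suc J                                  ≡⟨ cong (_C suc J) (sym (+-suc a u)) ⟩
    (a + suc u) C suc J                                  ∎

[1+n]C[1+k]*[1+k]≡[1+n]*nCk : ∀ n k → (suc n C suc k) * suc k ≡ suc n * (n C k)
[1+n]C[1+k]*[1+k]≡[1+n]*nCk zero    zero    = refl
[1+n]C[1+k]*[1+k]≡[1+n]*nCk zero    (suc k) = refl
[1+n]C[1+k]*[1+k]≡[1+n]*nCk (suc n) zero    =
  trans (*-identityʳ _) (trans (nC1≡n (suc (suc n))) (sym (*-identityʳ _)))
[1+n]C[1+k]*[1+k]≡[1+n]*nCk (suc n) (suc k) = begin
  (suc (suc n) C suc (suc k)) * suc (suc k)    ≡⟨ cong (_* suc (suc k)) (pascal (suc n) (suc k)) ⟩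
  (A + B) * suc (suc k)                        ≡⟨ expand A B k ⟩
  A + A * suc k + B * suc (suc k)              ≡⟨ cong₂ (λ x y → A + x + y) ([1+n]C[1+k]*[1+k]≡[1+n]*nCk n k)
                                                                          ([1+n]C[1+k]*[1+k]≡[1+n]*nCk n (suc k)) ⟩
  A + suc n * (n C k) + suc n * (n C suc k)    ≡⟨ +-assoc A _ _ ⟩
  A + (suc n * (n C k) + suc n * (n C suc k))  ≡⟨ cong (λ x → A + x) (*-distribˡ-+ (suc n) (n C k) (n C suc k)) ⟨
  A + suc n * (n C k + n C suc k)              ≡⟨ cong (λ x → A + suc n * x) (sym (pascal n k)) ⟩
  suc (suc n) * A                              ∎
  where
  open ≡-Reasoning
  A B : ℕ
  A = suc n C suc k
  B = suc n C suc (suc k)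
  expand : ∀ A B k → (A + B) * suc (suc k) ≡ A + A * suc k + B * suc (suc k)
  expand = ℕ-Solver.solve-∀

nC[1+k]*[1+k]≡nCk*[n∸k] : ∀ {n k} → k ≤ n → (n C suc k) * suc k ≡ (n C k) * (n ∸ k)
nC[1+k]*[1+k]≡nCk*[n∸k] {n} {k} k≤n = +-cancelˡ-≡ ((n C k) * suc k) _ _ (begin
  (n C k) * suc k + (n C suc k) * suc k  ≡⟨ *-distribʳ-+ (suc k) (n C k) (n C suc k) ⟨
  (n C k + n C suc k) * suc k            ≡⟨ cong (_* suc k) (pascal n k) ⟨
  (suc n C suc k) * suc k                ≡⟨ [1+n]C[1+k]*[1+k]≡[1+n]*nCk n k ⟩
  suc n * (n C k)                        ≡⟨ cong (λ m → suc m * (n C k)) (m+[n∸m]≡n k≤n) ⟨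
  suc (k + (n ∸ k)) * (n C k)            ≡⟨ split (n C k) k (n ∸ k) ⟩
  (n C k) * suc k + (n C k) * (n ∸ k)    ∎)
  where
  open ≡-Reasoning
  split : ∀ x k d → suc (k + d) * x ≡ x * suc k + x * d
  split = ℕ-Solver.solve-∀

nCk*[k!*[n∸k]!]≡n! : ∀ {n k} → k ≤ n → (n C k) * (k ! * (n ∸ k) !) ≡ n !
nCk*[k!*[n∸k]!]≡n! {n} {k} k≤n =
  trans (cong (_* (k ! * (n ∸ k) !)) (nCk≡n!/k![n-k]! k≤n))
        (m/n*n≡m {{k !* (n ∸ k) !≢0}} (k![n∸k]!∣n! k≤n))

digitFactor : ℕ → ℕ → ℤ
digitFactor q d = sgn d ℤ.* + (q C d)

sgn*digitFactor : ∀ q {i n} → i ≤ n → ∀ x →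
  sgn i ℤ.* (digitFactor q (n ∸ i) ℤ.* x) ≡ sgn n ℤ.* x ℤ.* + (q C (n ∸ i))
sgn*digitFactor q {i} {n} i≤n x = begin
  sgn i ℤ.* (sgn (n ∸ i) ℤ.* c ℤ.* x)  ≡⟨ regroup (sgn i) (sgn (n ∸ i)) c x ⟩
  sgn i ℤ.* sgn (n ∸ i) ℤ.* x ℤ.* c    ≡⟨ cong (λ s → s ℤ.* x ℤ.* c) (sgn-∸ i≤n) ⟩
  sgn n ℤ.* x ℤ.* c                    ∎
  where
  open ≡-Reasoning
  c : ℤ
  c = + (q C (n ∸ i))
  regroup : ∀ a b c x → a ℤ.* (b ℤ.* c ℤ.* x) ≡ a ℤ.* b ℤ.* x ℤ.* c
  regroup = ℤ-Solver.solve-∀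

altSum-1 : ∀ p n → altSum p 1 n ≡ D p n ℤ.- D p (n ∸ 1)
altSum-1 p n = cong₂ ℤ._+_ (ℤ.*-identityˡ (D p n)) (ℤ.-1*i≡-i (D p (n ∸ 1)))

module Digits (q : ℕ) (q≥1 : 1 ≤ q) where

  p : ℕ
  p = suc q

  Dfuel-0 : ∀ f → Dfuel p f 0 ≡ + 1
  Dfuel-0 zero    = refl
  Dfuel-0 (suc f) = trans (ℤ.*-identityˡ _) (Dfuel-0 f)

  [1+n]/p<1+n : ∀ n → suc n / p < suc n
  [1+n]/p<1+n n = m/n<m (suc n) p (s≤s q≥1)

  Dfuel-fuel : ∀ {f g} n → n ≤ f → n ≤ g → Dfuel p f n ≡ Dfuel p g n
  Dfuel-fuel {f}     {g}     zero    _         _         = trans (Dfuel-0 f) (sym (Dfuel-0 g))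
  Dfuel-fuel {suc f} {suc g} (suc n) (s≤s n≤f) (s≤s n≤g) =
    cong (digitFactor q (suc n % p) ℤ.*_)
      (Dfuel-fuel (suc n / p) (≤-trans (s≤s⁻¹ ([1+n]/p<1+n n)) n≤f) (≤-trans (s≤s⁻¹ ([1+n]/p<1+n n)) n≤g))

  D-rec : ∀ n → D p n ≡ digitFactor q (n % p) ℤ.* D p (n / p)
  D-rec zero    = refl
  D-rec (suc n) = cong (digitFactor q (suc n % p) ℤ.*_) (Dfuel-fuel (suc n / p) (s≤s⁻¹ ([1+n]/p<1+n n)) ≤-refl)

  D-digit : ∀ {d} n → d < p → D p (d + n * p) ≡ digitFactor q d ℤ.* D p n
  D-digit {d} n d<p = trans (D-rec (d + n * p)) (cong₂ (λ r m → digitFactor q r ℤ.* D p m) last rest)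
    where
    last : (d + n * p) % p ≡ d
    last = trans ([m+kn]%n≡m%n d n p) (m<n⇒m%n≡m d<p)
    rest : (d + n * p) / p ≡ n
    rest = trans (+-distrib-/-∣ʳ d (n∣m*n n)) (cong₂ _+_ (m<n⇒m/n≡0 d<p) (m*n/n≡m n p))

  split-trailing-zeros : ∀ n → 1 ≤ n → Σ[ t ∈ ℕ ] Σ[ r ∈ ℕ ] Σ[ Q ∈ ℕ ] r < q × n ≡ p ^ t * (suc r + Q * p)
  split-trailing-zeros = <-rec _ step
    where
    Split : ℕ → Set
    Split n = Σ[ t ∈ ℕ ] Σ[ r ∈ ℕ ] Σ[ Q ∈ ℕ ] r < q × n ≡ p ^ t * (suc r + Q * p)
    step : ∀ n → (∀ {m} → m < n → 1 ≤ m → Split m) → 1 ≤ n → Split n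
    step (suc n) ih _ with suc n % p | suc n / p | m≡m%n+[m/n]*n (suc n) p | m%n<n (suc n) p | [1+n]/p<1+n n
    ... | suc r | Q     | n≡         | s≤s r<q | _   = 0 , r , Q , r<q , trans n≡ (sym (*-identityˡ _))
    ... | zero  | zero  | ()         | _       | _
    ... | zero  | suc Q | n≡         | _       | Q<n with ih Q<n (s≤s z≤n)
    ...   | t , r , Q′ , r<q , Q≡ = suc t , r , Q′ , r<q ,
            trans n≡ (trans (cong (_* p) Q≡) (trans (*-comm _ p) (sym (*-assoc p (p ^ t) _))))

  D-noBorrow : ∀ {i j} M → i ≤ j → j ≤ q → D p (j + M * p ∸ i) ≡ digitFactor q (j ∸ i) ℤ.* D p M
  D-noBorrow {i} {j} M i≤j j≤q =
    trans (cong (D p) (+-∸-comm (M * p) i≤j)) (D-digit M (s≤s (≤-trans (m∸n≤m j i) j≤q)))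

  D-borrow : ∀ {i j} M → j < i → i ≤ p + j →
    D p (j + suc M * p ∸ i) ≡ digitFactor q (p + j ∸ i) ℤ.* D p M
  D-borrow {i} {j} M j<i i≤p+j = trans (cong (D p) shift) (D-digit M digit<p)
    where
    shift : j + suc M * p ∸ i ≡ p + j ∸ i + M * p
    shift = trans (cong (_∸ i) (rearrange j p (M * p))) (+-∸-comm (M * p) i≤p+j)
      where
      rearrange : ∀ a b c → a + (b + c) ≡ b + a + c
      rearrange = ℕ-Solver.solve-∀
    digit<p : p + j ∸ i < p
    digit<p = s≤s (≤-trans (∸-monoʳ-≤ (p + j) j<i) (≤-reflexive (m+n∸n≡m q j)))

  sgn[i]*D[j+M*p∸i] : ∀ {i j} M → i ≤ p + j → j ≤ q → 1 ≤ M →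
    sgn i ℤ.* D p (j + M * p ∸ i)
      ≡ sgn j ℤ.* D p M ℤ.* + C∸ q j i ℤ.+ sgn (p + j) ℤ.* D p (M ∸ 1) ℤ.* + C∸ q (p + j) i
  sgn[i]*D[j+M*p∸i] {i} {j} (suc M) i≤p+j j≤q _ with i ≤? j
  ... | yes i≤j = begin
    sgn i ℤ.* D p (j + suc M * p ∸ i)                  ≡⟨ cong (sgn i ℤ.*_) (D-noBorrow (suc M) i≤j j≤q) ⟩
    sgn i ℤ.* (digitFactor q (j ∸ i) ℤ.* D p (suc M))  ≡⟨ sgn*digitFactor q i≤j (D p (suc M)) ⟩
    α ℤ.* + (q C (j ∸ i))                              ≡⟨ ℤ.+-identityʳ _ ⟨
    α ℤ.* + (q C (j ∸ i)) ℤ.+ + 0                      ≡⟨ cong (λ z → α ℤ.* + (q C (j ∸ i)) ℤ.+ z) (ℤ.*-zeroʳ β) ⟨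
    α ℤ.* + (q C (j ∸ i)) ℤ.+ β ℤ.* + 0                ≡⟨ cong₂ (λ a b → α ℤ.* + a ℤ.+ β ℤ.* + b) (C∸-≤ q i≤j) vanish ⟨
    α ℤ.* + C∸ q j i ℤ.+ β ℤ.* + C∸ q (p + j) i        ∎
    where
    open ≡-Reasoning
    α β : ℤ
    α = sgn j ℤ.* D p (suc M)
    β = sgn (p + j) ℤ.* D p M
    vanish : C∸ q (p + j) i ≡ 0
    vanish = trans (C∸-≤ q i≤p+j)
                   (k>n⇒nCk≡0 (≤-trans (s≤s (m≤m+n q (j ∸ i))) (≤-reflexive (sym (+-∸-assoc p i≤j)))))
  ... | no i≰j = begin
    sgn i ℤ.* D p (j + suc M * p ∸ i)                  ≡⟨ cong (sgn i ℤ.*_) (D-borrow M j<i i≤p+j) ⟩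
    sgn i ℤ.* (digitFactor q (p + j ∸ i) ℤ.* D p M)    ≡⟨ sgn*digitFactor q i≤p+j (D p M) ⟩
    β ℤ.* + (q C (p + j ∸ i))                          ≡⟨ ℤ.+-identityˡ _ ⟨
    + 0 ℤ.+ β ℤ.* + (q C (p + j ∸ i))                  ≡⟨ cong (ℤ._+ β ℤ.* + (q C (p + j ∸ i))) (ℤ.*-zeroʳ α) ⟨
    α ℤ.* + 0 ℤ.+ β ℤ.* + (q C (p + j ∸ i))            ≡⟨ cong₂ (λ a b → α ℤ.* + a ℤ.+ β ℤ.* + b) (C∸-> q j<i) (C∸-≤ q i≤p+j) ⟨
    α ℤ.* + C∸ q j i ℤ.+ β ℤ.* + C∸ q (p + j) i        ∎
    where
    open ≡-Reasoning
    α β : ℤ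
    α = sgn j ℤ.* D p (suc M)
    β = sgn (p + j) ℤ.* D p M
    j<i : j < i
    j<i = ≰⇒> i≰j

  altSum[j+M*p] : ∀ {u j} M → u ≤ q → j ≤ q → 1 ≤ M →
    altSum p u (j + M * p)
      ≡ sgn j ℤ.* D p M ℤ.* + ((q + u) C j) ℤ.+ sgn (p + j) ℤ.* D p (M ∸ 1) ℤ.* + ((q + u) C (p + j))
  altSum[j+M*p] {u} {j} M u≤q j≤q M≥1 = begin
    altSum p u (j + M * p)                             ≡⟨ sumTo-cong u term ⟩
    sumTo (λ i → α ℤ.* + F i ℤ.+ β ℤ.* + G i) u        ≡⟨ sumTo-linear α β (λ i → + F i) (λ i → + G i) u ⟩
    α ℤ.* sumTo (λ i → + F i) u ℤ.+ β ℤ.* sumTo (λ i → + G i) u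
      ≡⟨ cong₂ (λ a b → α ℤ.* a ℤ.+ β ℤ.* b) (trans (sumTo-pos F u) (cong +_ (vandermonde q u j)))
                                             (trans (sumTo-pos G u) (cong +_ (vandermonde q u (p + j)))) ⟩
    α ℤ.* + ((q + u) C j) ℤ.+ β ℤ.* + ((q + u) C (p + j)) ∎
    where
    open ≡-Reasoning
    α β : ℤ
    α = sgn j ℤ.* D p M
    β = sgn (p + j) ℤ.* D p (M ∸ 1)
    F G : ℕ → ℕ
    F i = (u C i) * C∸ q j i
    G i = (u C i) * C∸ q (p + j) i
    distrib : ∀ s U x α a β b → s ℤ.* x ≡ α ℤ.* a ℤ.+ β ℤ.* b →
      s ℤ.* U ℤ.* x ≡ α ℤ.* (U ℤ.* a) ℤ.+ β ℤ.* (U ℤ.* b)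
    distrib s U x α a β b eq = trans (swap s U x) (trans (cong (U ℤ.*_) eq) (spread U α a β b))
      where
      swap : ∀ s U x → s ℤ.* U ℤ.* x ≡ U ℤ.* (s ℤ.* x)
      swap = ℤ-Solver.solve-∀
      spread : ∀ U α a β b → U ℤ.* (α ℤ.* a ℤ.+ β ℤ.* b) ≡ α ℤ.* (U ℤ.* a) ℤ.+ β ℤ.* (U ℤ.* b)
      spread = ℤ-Solver.solve-∀
    term : ∀ i → i ≤ u → sgn i ℤ.* + (u C i) ℤ.* D p (j + M * p ∸ i) ≡ α ℤ.* + F i ℤ.+ β ℤ.* + G i
    term i i≤u =
      trans (distrib (sgn i) (+ (u C i)) _ α _ β _ (sgn[i]*D[j+M*p∸i] M i≤p+j j≤q M≥1))
            (cong₂ (λ a b → α ℤ.* a ℤ.+ β ℤ.* b) (sym (ℤ.pos-* (u C i) (C∸ q j i)))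
                                                 (sym (ℤ.pos-* (u C i) (C∸ q (p + j) i))))
      where
      i≤p+j : i ≤ p + j
      i≤p+j = ≤-trans i≤u (≤-trans u≤q (≤-trans (n≤1+n q) (m≤m+n p j)))

module OddDigits (q : ℕ) (q≥1 : 1 ≤ q) (sgn-q : sgn q ≡ + 1) where

  open Digits q q≥1 public

  sgn[p+n]≡-sgn[n] : ∀ n → sgn (p + n) ≡ - sgn n
  sgn[p+n]≡-sgn[n] n = cong -_ (trans (sgn-+ q n) (trans (cong (ℤ._* sgn n) sgn-q) (ℤ.*-identityˡ (sgn n))))

  D-p* : ∀ n → D p (p * n) ≡ D p n
  D-p* n = trans (cong (D p) (*-comm p n)) (trans (D-digit n (s≤s z≤n)) (ℤ.*-identityˡ (D p n)))

  D-p*∸1 : ∀ {m} → 1 ≤ m → D p (p * m ∸ 1) ≡ D p (m ∸ 1)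
  D-p*∸1 {suc n} _ = begin
    D p (p * suc n ∸ 1)              ≡⟨ cong (λ x → D p (x ∸ 1)) (trans (*-suc p n) (cong (λ x → p + x) (*-comm p n))) ⟩
    D p (q + n * p)                  ≡⟨ D-digit n ≤-refl ⟩
    digitFactor q q ℤ.* D p n        ≡⟨ cong₂ (λ s c → s ℤ.* + c ℤ.* D p n) sgn-q (nCn≡1 q) ⟩
    + 1 ℤ.* + 1 ℤ.* D p n            ≡⟨ ℤ.*-identityˡ (D p n) ⟩
    D p n                            ∎
    where open ≡-Reasoning

  D-p^t* : ∀ t n → D p (p ^ t * n) ≡ D p n
  D-p^t* zero    n = cong (D p) (*-identityˡ n)
  D-p^t* (suc t) n = trans (cong (D p) (*-assoc p (p ^ t) n)) (trans (D-p* (p ^ t * n)) (D-p^t* t n))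

  D-p^t*∸1 : ∀ t {m} → 1 ≤ m → D p (p ^ t * m ∸ 1) ≡ D p (m ∸ 1)
  D-p^t*∸1 zero    {m} _   = cong (λ x → D p (x ∸ 1)) (*-identityˡ m)
  D-p^t*∸1 (suc t) {m} m≥1 =
    trans (cong (λ x → D p (x ∸ 1)) (*-assoc p (p ^ t) m))
          (trans (D-p*∸1 (*-mono-≤ (m^n>0 p t) m≥1)) (D-p^t*∸1 t m≥1))

  altSum-closedForm : ∀ {u} n″ k′ s′ j → u ≤ q → suc k′ ≤ q → j ≤ q →
    altSum p u (n″ * p ^ (suc s′ + 1) + suc k′ * p ^ suc s′ + j)
      ≡ sgn (j + suc k′) ℤ.* (D p n″ ℤ.* + ((q C suc k′) * ((q + u) C j) + (q C k′) * ((q + u) C (p + j))))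
  altSum-closedForm {u} n″ k′ s′ j u≤q k≤q j≤q = begin
    altSum p u (n″ * p ^ (suc s′ + 1) + suc k′ * p ^ suc s′ + j)
      ≡⟨ cong (altSum p u) window ⟩
    altSum p u (j + M * p)
      ≡⟨ altSum[j+M*p] M u≤q j≤q M≥1 ⟩
    sgn j ℤ.* D p M ℤ.* + A ℤ.+ sgn (p + j) ℤ.* D p (M ∸ 1) ℤ.* + B
      ≡⟨ cong₂ (λ x y → sgn j ℤ.* x ℤ.* + A ℤ.+ y ℤ.* + B) DM (cong₂ ℤ._*_ (sgn[p+n]≡-sgn[n] j) DM∸1) ⟩
    sgn j ℤ.* (digitFactor q (suc k′) ℤ.* R) ℤ.* + A ℤ.+ - sgn j ℤ.* (digitFactor q k′ ℤ.* R) ℤ.* + B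
      ≡⟨ collect (sgn j) (sgn k′) R (+ (q C suc k′)) (+ (q C k′)) (+ A) (+ B) ⟩
    sgn j ℤ.* sgn (suc k′) ℤ.* (R ℤ.* (+ (q C suc k′) ℤ.* + A ℤ.+ + (q C k′) ℤ.* + B))
      ≡⟨ cong₂ (λ s x → s ℤ.* (R ℤ.* x)) (sym (sgn-+ j (suc k′)))
               (trans (cong₂ ℤ._+_ (sym (ℤ.pos-* (q C suc k′) A)) (sym (ℤ.pos-* (q C k′) B)))
                      (sym (ℤ.pos-+ ((q C suc k′) * A) ((q C k′) * B)))) ⟩
    sgn (j + suc k′) ℤ.* (R ℤ.* + ((q C suc k′) * A + (q C k′) * B))
      ∎
    where
    open ≡-Reasoning
    N : ℕ
    N = suc k′ + n″ * p
    M : ℕ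
    M = p ^ s′ * N
    R : ℤ
    R = D p n″
    A B : ℕ
    A = (q + u) C j
    B = (q + u) C (p + j)
    window : n″ * p ^ (suc s′ + 1) + suc k′ * p ^ suc s′ + j ≡ j + M * p
    window = trans (cong (λ e → n″ * p ^ e + suc k′ * p ^ suc s′ + j) (+-comm (suc s′) 1))
                   (expand n″ (suc k′) p (p ^ s′) j)
      where
      expand : ∀ a b P P′ j → a * (P * (P * P′)) + b * (P * P′) + j ≡ j + P′ * (b + a * P) * P
      expand = ℕ-Solver.solve-∀
    M≥1 : 1 ≤ M
    M≥1 = *-mono-≤ (m^n>0 p s′) (s≤s z≤n)
    DM : D p M ≡ digitFactor q (suc k′) ℤ.* R
    DM = trans (D-p^t* s′ N) (D-digit n″ (s≤s (≤-trans k≤q ≤-refl)))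
    DM∸1 : D p (M ∸ 1) ≡ digitFactor q k′ ℤ.* R
    DM∸1 = trans (D-p^t*∸1 s′ (s≤s z≤n)) (D-digit n″ (s≤s (≤-trans (n≤1+n k′) k≤q)))
    collect : ∀ sj sk R Ck Ck′ A B →
      sj ℤ.* (- sk ℤ.* Ck ℤ.* R) ℤ.* A ℤ.+ - sj ℤ.* (sk ℤ.* Ck′ ℤ.* R) ℤ.* B
        ≡ sj ℤ.* - sk ℤ.* (R ℤ.* (Ck ℤ.* A ℤ.+ Ck′ ℤ.* B))
    collect = ℤ-Solver.solve-∀

  k*∣altSum∣ : ∀ {u} n″ k′ s′ j → u ≤ q → suc k′ ≤ q → j ≤ q →
    suc k′ * ∣ altSum p u (n″ * p ^ (suc s′ + 1) + suc k′ * p ^ suc s′ + j) ∣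
      ≡ ∣ D p n″ ∣ * (q C k′) * ((q ∸ k′) * ((q + u) C j) + suc k′ * ((q + u) C (p + j)))
  k*∣altSum∣ {u} n″ k′ s′ j u≤q k≤q j≤q = begin
    suc k′ * ∣ altSum p u (n″ * p ^ (suc s′ + 1) + suc k′ * p ^ suc s′ + j) ∣
      ≡⟨ cong (λ x → suc k′ * ∣ x ∣) (altSum-closedForm n″ k′ s′ j u≤q k≤q j≤q) ⟩
    suc k′ * ∣ sgn (j + suc k′) ℤ.* (D p n″ ℤ.* + ((q C suc k′) * A + (q C k′) * B)) ∣
      ≡⟨ cong (suc k′ *_) (trans (∣sgn*i∣≡∣i∣ (j + suc k′) _) (ℤ.abs-* (D p n″) _)) ⟩
    suc k′ * (R * ((q C suc k′) * A + (q C k′) * B))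
      ≡⟨ regroup (suc k′) R (q C suc k′) A (q C k′) B ⟩
    R * ((q C suc k′) * suc k′ * A + (q C k′) * (suc k′ * B))
      ≡⟨ cong (λ x → R * (x * A + (q C k′) * (suc k′ * B))) (nC[1+k]*[1+k]≡nCk*[n∸k] (≤-trans (n≤1+n k′) k≤q)) ⟩
    R * ((q C k′) * (q ∸ k′) * A + (q C k′) * (suc k′ * B))
      ≡⟨ factor R (q C k′) (q ∸ k′) A (suc k′) B ⟩
    R * (q C k′) * ((q ∸ k′) * A + suc k′ * B)
      ∎
    where
    open ≡-Reasoning
    R : ℕ
    R = ∣ D p n″ ∣
    A B : ℕ
    A = (q + u) C j
    B = (q + u) C (p + j)
    regroup : ∀ k R Ck A Ck′ B → k * (R * (Ck * A + Ck′ * B)) ≡ R * (Ck * k * A + Ck′ * (k * B))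
    regroup = ℕ-Solver.solve-∀
    factor : ∀ R Ck′ d A k B → R * (Ck′ * d * A + Ck′ * (k * B)) ≡ R * Ck′ * (d * A + k * B)
    factor = ℕ-Solver.solve-∀

  ∣altSum₁[p^t*N]∣ : ∀ t {r} Q → r < q → ∣ altSum p 1 (p ^ t * (suc r + Q * p)) ∣ ≡ ∣ D p Q ∣ * (p C suc r)
  ∣altSum₁[p^t*N]∣ t {r} Q r<q = begin
    ∣ altSum p 1 (p ^ t * N) ∣
      ≡⟨ cong ∣_∣ (altSum-1 p (p ^ t * N)) ⟩
    ∣ D p (p ^ t * N) ℤ.- D p (p ^ t * N ∸ 1) ∣
      ≡⟨ cong₂ (λ x y → ∣ x ℤ.- y ∣) (trans (D-p^t* t N) (D-digit Q (s≤s r<q)))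
                                     (trans (D-p^t*∸1 t (s≤s z≤n)) (D-digit Q (m<n⇒m<1+n r<q))) ⟩
    ∣ digitFactor q (suc r) ℤ.* R ℤ.- digitFactor q r ℤ.* R ∣
      ≡⟨ cong ∣_∣ (collect (sgn r) (+ (q C suc r)) (+ (q C r)) R) ⟩
    ∣ sgn (suc r) ℤ.* (R ℤ.* (+ (q C r) ℤ.+ + (q C suc r))) ∣
      ≡⟨ trans (∣sgn*i∣≡∣i∣ (suc r) _) (ℤ.abs-* R _) ⟩
    ∣ R ∣ * ∣ + (q C r) ℤ.+ + (q C suc r) ∣
      ≡⟨ cong (λ x → ∣ R ∣ * ∣ x ∣) (ℤ.pos-+ (q C r) (q C suc r)) ⟨
    ∣ R ∣ * (q C r + q C suc r)
      ≡⟨ cong (∣ R ∣ *_) (nCk+nC[k+1]≡[n+1]C[k+1] q r) ⟩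
    ∣ R ∣ * (p C suc r)
      ∎
    where
    open ≡-Reasoning
    N : ℕ
    N = suc r + Q * p
    R : ℤ
    R = D p Q
    collect : ∀ s a b R → - s ℤ.* a ℤ.* R ℤ.- s ℤ.* b ℤ.* R ≡ - s ℤ.* (R ℤ.* (b ℤ.+ a))
    collect = ℤ-Solver.solve-∀

module ModP (q : ℕ) (q≥1 : 1 ≤ q) (isPrime : Prime (suc q)) where

  open Digits q q≥1

  0<m<p⇒p∤m : ∀ {m} → 0 < m → m < p → ¬ p ∣ m
  0<m<p⇒p∤m {suc m} _ m<p p∣m = <⇒≱ m<p (∣⇒≤ p∣m)

  p∤1 : ¬ p ∣ 1
  p∤1 = 0<m<p⇒p∤m (s≤s z≤n) (s≤s q≥1)

  p∤1+p : ¬ p ∣ suc p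
  p∤1+p p∣1+p = p∤1 (∣m+n∣m⇒∣n (subst (p ∣_) (+-comm 1 p) p∣1+p) ∣-refl)

  p∤* : ∀ {a b} → ¬ p ∣ a → ¬ p ∣ b → ¬ p ∣ a * b
  p∤* p∤a p∤b p∣ab = [ p∤a , p∤b ] (euclidsLemma _ _ isPrime p∣ab)

  p∤m! : ∀ {m} → m < p → ¬ p ∣ m !
  p∤m! {zero}  _   = p∤1
  p∤m! {suc m} m<p = p∤* (0<m<p⇒p∤m (s≤s z≤n) m<p) (p∤m! (<-trans (n<1+n m) m<p))

  p∤qCd : ∀ {d} → d ≤ q → ¬ p ∣ q C d
  p∤qCd {d} d≤q p∣C = p∤m! ≤-refl (subst (p ∣_) (nCk*[k!*[n∸k]!]≡n! d≤q) (∣m⇒∣m*n _ p∣C))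

  p∤∣D∣ : ∀ n → ¬ p ∣ ∣ D p n ∣
  p∤∣D∣ = <-rec (λ n → ¬ p ∣ ∣ D p n ∣) step
    where
    step : ∀ n → (∀ {m} → m < n → ¬ p ∣ ∣ D p m ∣) → ¬ p ∣ ∣ D p n ∣
    step zero    _  = p∤1
    step (suc n) ih = p∤* (p∤qCd (s≤s⁻¹ (m%n<n (suc n) p))) (ih ([1+n]/p<1+n n)) ∘ subst (p ∣_) ∣D∣≡
      where
      d : ℕ
      d = suc n % p
      ∣D∣≡ : ∣ D p (suc n) ∣ ≡ (q C d) * ∣ D p (suc n / p) ∣
      ∣D∣≡ = trans (cong ∣_∣ (D-rec (suc n)))
             (trans (ℤ.abs-* (digitFactor q d) (D p (suc n / p)))
                    (cong (_* ∣ D p (suc n / p) ∣) (∣sgn*i∣≡∣i∣ d (+ (q C d)))))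

  p^v∣a*x⇒p^v∣x : ∀ {a} → ¬ p ∣ a → ∀ v {x} → p ^ v ∣ a * x → p ^ v ∣ x
  p^v∣a*x⇒p^v∣x p∤a zero    _ = 1∣ _
  p^v∣a*x⇒p^v∣x {a} p∤a (suc v) {x} p^[1+v]∣ax with p^v∣a*x⇒p^v∣x p∤a v (m*n∣⇒n∣ p (p ^ v) p^[1+v]∣ax)
  ... | divides y refl = *-monoˡ-∣ (p ^ v) p∣y
    where
    instance
      p^v≢0 : NonZero (p ^ v)
      p^v≢0 = m^n≢0 p v
    p∣ay : p ∣ a * y
    p∣ay = *-cancelˡ-∣ (p ^ v) (subst₂ _∣_ (*-comm p (p ^ v)) (regroup a y (p ^ v)) p^[1+v]∣ax)
      where
      regroup : ∀ a y P → a * (y * P) ≡ P * (a * y)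
      regroup = ℕ-Solver.solve-∀
    p∣y : p ∣ y
    p∣y = [ (λ p∣a → ⊥-elim (p∤a p∣a)) , id ] (euclidsLemma a y isPrime p∣ay)

  p^v∣-cancel : ∀ {a b x y} → ¬ p ∣ a → a * x ≡ b * y → ∀ v → p ^ v ∣ y → p ^ v ∣ x
  p^v∣-cancel {b = b} p∤a ax≡by v p^v∣y = p^v∣a*x⇒p^v∣x p∤a v (subst (p ^ v ∣_) (sym ax≡by) (∣n⇒∣m*n b p^v∣y))

  IsVal-*ˡ : ∀ {a} → ¬ p ∣ a → ∀ x v → IsVal p (a * x) v ⇔ IsVal p x v
  IsVal-*ˡ {a} p∤a x v = mk⇔
    (λ (p^v∣ax , p^[1+v]∤ax) → p^v∣a*x⇒p^v∣x p∤a v p^v∣ax , p^[1+v]∤ax ∘ ∣n⇒∣m*n a)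
    (λ (p^v∣x , p^[1+v]∤x) → ∣n⇒∣m*n a p^v∣x , p^[1+v]∤x ∘ p^v∣a*x⇒p^v∣x p∤a (suc v))

  IsVal-cancel : ∀ {a b x y} → ¬ p ∣ a → ¬ p ∣ b → a * x ≡ b * y → ∀ v → IsVal p x v ⇔ IsVal p y v
  IsVal-cancel {a} {b} {x} {y} p∤a p∤b ax≡by v =
    IsVal-*ˡ p∤b y v ⇔-∘ (subst (λ z → IsVal p (a * x) v ⇔ IsVal p z v) ax≡by (⇔-id _) ⇔-∘ ⇔-sym (IsVal-*ˡ p∤a x v))

  IsVal-1 : ∀ {x} → p ∣ x → ¬ p * p ∣ x → IsVal p x 1
  IsVal-1 {x} p∣x p²∤x =
    subst (_∣ x) (sym (*-identityʳ p)) p∣x , p²∤x ∘ subst (_∣ x) (cong (p *_) (*-identityʳ p))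

  [p+m]!≡p*Y : ∀ {m} → m < p → Σ[ Y ∈ ℕ ] (p + m) ! ≡ p * Y × ¬ p ∣ Y
  [p+m]!≡p*Y {zero}  _   = q ! , cong _! (+-identityʳ p) , p∤m! ≤-refl
  [p+m]!≡p*Y {suc m} m<p with [p+m]!≡p*Y (<-trans (n<1+n m) m<p)
  ... | Y , [p+m]!≡ , p∤Y = suc (p + m) * Y , [p+1+m]!≡ , p∤* p∤1+p+m p∤Y
    where
    [p+1+m]!≡ : (p + suc m) ! ≡ p * (suc (p + m) * Y)
    [p+1+m]!≡ = trans (cong _! (+-suc p m))
                      (trans (cong (suc (p + m) *_) [p+m]!≡) (x∙yz≈y∙xz (suc (p + m)) p Y))
    p∤1+p+m : ¬ p ∣ suc (p + m)
    p∤1+p+m p∣ = 0<m<p⇒p∤m (s≤s z≤n) m<p (∣m+n∣m⇒∣n (subst (p ∣_) (sym (+-suc p m)) p∣) ∣-refl)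

  IsVal-[p+m]Cj : ∀ {m j} → m < j → j ≤ q → IsVal p ((p + m) C j) 1
  IsVal-[p+m]Cj {m} {j} m<j j≤q with [p+m]!≡p*Y (<-trans m<j (s≤s j≤q))
  ... | Y , [p+m]!≡ , p∤Y = IsVal-1 p∣C p²∤C
    where
    C*E≡p*Y : ((p + m) C j) * (j ! * (p + m ∸ j) !) ≡ p * Y
    C*E≡p*Y = trans (nCk*[k!*[n∸k]!]≡n! (≤-trans j≤q (≤-trans (n≤1+n q) (m≤m+n p m)))) [p+m]!≡
    p∤E : ¬ p ∣ j ! * (p + m ∸ j) !
    p∤E = p∤* (p∤m! (s≤s j≤q)) (p∤m! (s≤s (≤-trans (∸-monoʳ-≤ (p + m) m<j) (≤-reflexive (m+n∸n≡m q m)))))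
    p∣C : p ∣ (p + m) C j
    p∣C = [ id , (λ p∣E → ⊥-elim (p∤E p∣E)) ] (euclidsLemma ((p + m) C j) _ isPrime (subst (p ∣_) (sym C*E≡p*Y) (m∣m*n Y)))
    p²∤C : ¬ p * p ∣ (p + m) C j
    p²∤C p²∣C = p∤Y (*-cancelˡ-∣ p (subst (p * p ∣_) C*E≡p*Y (∣m⇒∣m*n _ p²∣C)))

  [p+m]Cp≡1+p*t : ∀ {m} → m < p → Σ[ t ∈ ℕ ] (p + m) C p ≡ 1 + p * t
  [p+m]Cp≡1+p*t {zero}  _ = 0 , trans (cong (_C p) (+-identityʳ p)) (trans (nCn≡1 p) (cong suc (sym (*-zeroʳ p))))
  [p+m]Cp≡1+p*t {suc m} (s≤s m<q) with [p+m]Cp≡1+p*t (m<n⇒m<1+n m<q) | proj₁ (IsVal-[p+m]Cj m<q ≤-refl)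
  ... | t , [p+m]Cp≡ | divides a [p+m]Cq≡ = a + t , (begin
    (p + suc m) C p            ≡⟨ cong (_C p) (+-suc p m) ⟩
    suc (p + m) C suc q        ≡⟨ pascal (p + m) q ⟩
    (p + m) C q + (p + m) C p  ≡⟨ cong₂ _+_ [p+m]Cq≡ [p+m]Cp≡ ⟩
    a * (p * 1) + (1 + p * t)  ≡⟨ collect a p t ⟩
    1 + p * (a + t)            ∎)
    where
    open ≡-Reasoning
    collect : ∀ a p t → a * (p * 1) + (1 + p * t) ≡ 1 + p * (a + t)
    collect = ℕ-Solver.solve-∀

  p∤⇒coprime : ∀ {a} → ¬ p ∣ a → Coprime p a
  p∤⇒coprime p∤a (d∣p , d∣a) with prime⇒irreducible isPrime d∣p
  ... | inj₁ d≡1  = d≡1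
  ... | inj₂ refl = ⊥-elim (p∤a d∣a)

  linear-congruence : ∀ {a} → ¬ p ∣ a → ∀ b → Σ[ K ∈ ℕ ] p ∣ K * a + b
  linear-congruence {a} p∤a b with coprime-Bézout (p∤⇒coprime p∤a)
  ... | Bézout.+- x y 1+ya≡xp = y * b , divides (b * x) (begin
    y * b * a + b  ≡⟨ factor y b a ⟩
    b * (1 + y * a) ≡⟨ cong (b *_) 1+ya≡xp ⟩
    b * (x * p)    ≡⟨ *-assoc b x p ⟨
    b * x * p      ∎)
    where
    open ≡-Reasoning
    factor : ∀ y b a → y * b * a + b ≡ b * (1 + y * a)
    factor = ℕ-Solver.solve-∀
  ... | Bézout.-+ x y 1+xp≡ya = y * b * q , divides (b + b * q * x) (begin
    y * b * q * a + b      ≡⟨ factor y b q a ⟩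
    b * q * (y * a) + b    ≡⟨ cong (λ z → b * q * z + b) 1+xp≡ya ⟨
    b * q * (1 + x * p) + b ≡⟨ expand b q x ⟩
    (b + b * q * x) * p    ∎)
    where
    open ≡-Reasoning
    factor : ∀ y b q a → y * b * q * a + b ≡ b * q * (y * a) + b
    factor = ℕ-Solver.solve-∀
    expand : ∀ b q x → b * q * (1 + x * suc q) + b ≡ (b + b * q * x) * suc q
    expand = ℕ-Solver.solve-∀

  p∣K*a+b⇒p∣[K%p]*a+b : ∀ {a b} K → p ∣ K * a + b → p ∣ K % p * a + b
  p∣K*a+b⇒p∣[K%p]*a+b {a} {b} K p∣Ka+b = ∣m+n∣m⇒∣n (subst (p ∣_) split p∣Ka+b) (n∣m*n (K / p * a))
    where
    rearrange : ∀ r d a b p → (r + d * p) * a + b ≡ d * a * p + (r * a + b)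
    rearrange = ℕ-Solver.solve-∀
    split : K * a + b ≡ K / p * a * p + (K % p * a + b)
    split = trans (cong (λ K → K * a + b) (m≡m%n+[m/n]*n K p)) (rearrange (K % p) (K / p) a b p)

  inverse : ∀ {a b} → ¬ p ∣ a → ¬ p ∣ b → Σ[ k′ ∈ ℕ ] suc k′ ≤ q × p ∣ suc k′ * a + b
  inverse {a} {b} p∤a p∤b with linear-congruence p∤a b
  ... | K , p∣Ka+b with K % p | m%n<n K p | p∣K*a+b⇒p∣[K%p]*a+b K p∣Ka+b
  ...   | zero   | _           | p∣b    = ⊥-elim (p∤b p∣b)
  ...   | suc k′ | s≤s k′<q | p∣k′a+b = k′ , k′<q , p∣k′a+b

module OddPrime (q : ℕ) (isPrime : Prime (suc q)) (q≥2 : 2 ≤ q) where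

  q≥1 : 1 ≤ q
  q≥1 = ≤-trans (s≤s z≤n) q≥2

  sgn[q]≡1 : sgn q ≡ + 1
  sgn[q]≡1 with q % 2 | q / 2 | m≡m%n+[m/n]*n q 2 | m%n<n q 2
  ... | zero        | h | q≡ | _ = trans (cong sgn q≡) (sgn[n*2]≡1 h)
  ... | suc zero    | h | q≡ | _ with prime⇒irreducible isPrime (divides (suc h) (cong suc q≡))
  ...   | inj₁ ()
  ...   | inj₂ 2≡p = ⊥-elim (<⇒≱ q≥2 (≤-reflexive (sym (suc-injective 2≡p))))
  sgn[q]≡1 | suc (suc _) | _ | _ | s≤s (s≤s ())

  open OddDigits q q≥1 sgn[q]≡1
  open ModP q q≥1 isPrime

  binomCombo : ℕ → ℕ → ℕ → ℕ
  binomCombo u j k = (p ∸ k) * ((p + u ∸ 1) C j) + k * ((p + u ∸ 1) C (p + j))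

  p∤1+k′ : ∀ {k′} → suc k′ ≤ q → ¬ p ∣ suc k′
  p∤1+k′ k≤q = 0<m<p⇒p∤m (s≤s z≤n) (s≤s k≤q)

  p∤∣D∣*qCk′ : ∀ n″ {k′} → suc k′ ≤ q → ¬ p ∣ ∣ D p n″ ∣ * (q C k′)
  p∤∣D∣*qCk′ n″ k≤q = p∤* (p∤∣D∣ n″) (p∤qCd (≤-trans (n≤1+n _) k≤q))

  valuation-altSum : (u : ℕ) → 1 ≤ u → u ≤ q →
    (n n″ k s j : ℕ) → 1 ≤ k → k ≤ q → 1 ≤ s → j ≤ q →
    p ≤ n → n ≡ n″ * p ^ (s + 1) + k * p ^ s + j →
    (v : ℕ) → IsVal p ∣ altSum p u n ∣ v ⇔ IsVal p (binomCombo u j k) v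
  valuation-altSum u _ u≤q _ n″ (suc k′) (suc s′) j _ k≤q _ j≤q _ refl =
    IsVal-cancel (p∤1+k′ k≤q) (p∤∣D∣*qCk′ n″ k≤q) (k*∣altSum∣ n″ k′ s′ j u≤q k≤q j≤q)

  p²∣binomCombo⇒p²∣altSum : ∀ {u j k′} → u ≤ q → j ≤ q → suc k′ ≤ q →
    p ^ 2 ∣ binomCombo u j (suc k′) →
    (n″ s : ℕ) → 1 ≤ s → p ^ 2 ∣ ∣ altSum p u (n″ * p ^ (s + 1) + suc k′ * p ^ s + j) ∣
  p²∣binomCombo⇒p²∣altSum {j = j} {k′} u≤q j≤q k≤q p²∣combo n″ (suc s′) _ =
    p^v∣-cancel {b = ∣ D p n″ ∣ * (q C k′)} (p∤1+k′ k≤q) (k*∣altSum∣ n″ k′ s′ j u≤q k≤q j≤q) 2 p²∣combo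

  altSum₁-valuation : (n : ℕ) → 1 ≤ n → IsVal p ∣ altSum p 1 n ∣ 1
  altSum₁-valuation n n≥1 with split-trailing-zeros n n≥1
  ... | t , r , Q , r<q , refl =
    subst (λ x → IsVal p x 1) (sym (∣altSum₁[p^t*N]∣ t Q r<q))
          (Equivalence.from (IsVal-*ˡ (p∤∣D∣ Q) _ 1)
             (subst (λ n → IsVal p (n C suc r) 1) (+-identityʳ p) (IsVal-[p+m]Cj (s≤s z≤n) r<q)))

  valuation-altSum-u≤j : (u : ℕ) → 1 ≤ u → u ≤ q →
    (n n″ k s j : ℕ) → 1 ≤ k → k ≤ q → 1 ≤ s → j ≤ q →
    p ≤ n → n ≡ n″ * p ^ (s + 1) + k * p ^ s + j →
    u ≤ j → IsVal p ∣ altSum p u n ∣ 1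
  valuation-altSum-u≤j (suc m) u≥1 u≤q n n″ (suc k′) s j k≥1 k≤q s≥1 j≤q p≤n n≡ u≤j =
    Equivalence.from (valuation-altSum (suc m) u≥1 u≤q n n″ (suc k′) s j k≥1 k≤q s≥1 j≤q p≤n n≡ 1)
      (subst (λ x → IsVal p x 1) (sym combo≡)
        (Equivalence.from (IsVal-*ˡ p∤q∸k′ _ 1)
          (subst (λ n → IsVal p (n C j) 1) (sym (+-suc q m)) (IsVal-[p+m]Cj u≤j j≤q))))
    where
    p∤q∸k′ : ¬ p ∣ q ∸ k′
    p∤q∸k′ = 0<m<p⇒p∤m (m<n⇒0<n∸m k≤q) (s≤s (m∸n≤m q k′))
    combo≡ : binomCombo (suc m) j (suc k′) ≡ (q ∸ k′) * ((q + suc m) C j)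
    combo≡ = trans (cong (λ x → (q ∸ k′) * ((q + suc m) C j) + suc k′ * x) (k>n⇒nCk≡0 (s≤s (+-monoʳ-≤ q u≤j))))
                   (trans (cong (λ x → (q ∸ k′) * ((q + suc m) C j) + x) (*-zeroʳ (suc k′))) (+-identityʳ _))

  p^2∣p*x : ∀ {x} → p ∣ x → p ^ 2 ∣ p * x
  p^2∣p*x {x} p∣x = subst (_∣ p * x) (cong (p *_) (sym (*-identityʳ p))) (*-monoʳ-∣ p p∣x)

  p²∣binomCombo[j=0] : ∀ {m t k′} → suc k′ ≤ q → (p + m) C p ≡ 1 + p * t → p ∣ suc k′ * t + 1 →
    p ^ 2 ∣ binomCombo (suc m) 0 (suc k′)
  p²∣binomCombo[j=0] {m} {t} {k′} k≤q [p+m]Cp≡ p∣kt+1 = subst (p ^ 2 ∣_) (sym combo≡) (p^2∣p*x p∣kt+1)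
    where
    k : ℕ
    k = suc k′
    combine : ∀ K′ K t P → K′ + K ≡ P → K′ * 1 + K * (1 + P * t) ≡ P * (K * t + 1)
    combine K′ K t _ refl = expand K′ K t
      where
      expand : ∀ K′ K t → K′ * 1 + K * (1 + (K′ + K) * t) ≡ (K′ + K) * (K * t + 1)
      expand = ℕ-Solver.solve-∀
    combo≡ : binomCombo (suc m) 0 k ≡ p * (k * t + 1)
    combo≡ = trans (cong (λ x → (q ∸ k′) * 1 + k * x) (trans (cong₂ _C_ (+-suc q m) (+-identityʳ p)) [p+m]Cp≡))
                   (combine (q ∸ k′) k t p (trans (+-suc (q ∸ k′) k′) (cong suc (m∸n+n≡m (≤-trans (n≤1+n k′) k≤q)))))

  p²∣binomCombo[j=1] : ∀ {m r K′} → suc K′ ≤ q → (p + m) C p ≡ 1 + p * (r * p) → p ∣ suc K′ * suc m + m →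
    p ^ 2 ∣ binomCombo (suc m) 1 (suc (q ∸ suc K′))
  -- B = C(p+m, p+1) is only accessible through (p+1)B = m C(p+m, p), so we show
  -- p² ∣ (p+1)·binomCombo and cancel the unit p+1.
  p²∣binomCombo[j=1] {m} {r} {K′} K≤q [p+m]Cp≡ p∣K[1+m]+m =
    p^v∣a*x⇒p^v∣x p∤1+p 2 (subst (p ^ 2 ∣_) (sym [1+p]*combo≡) p²∣)
    where
    K : ℕ
    K = suc K′
    k : ℕ
    k = suc (q ∸ K)
    p≡K+k : p ≡ K + k
    p≡K+k = cong suc (sym (trans (+-suc K′ (q ∸ K)) (m+[n∸m]≡n K≤q)))
    B : ℕ
    B = (p + m) C suc p
    B*[1+p]≡ : B * suc p ≡ (1 + p * (r * p)) * m
    B*[1+p]≡ = trans (nC[1+k]*[1+k]≡nCk*[n∸k] (m≤m+n p m)) (cong₂ _*_ [p+m]Cp≡ (m+n∸m≡n p m))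
    combine : ∀ K k m r B P → P ≡ K + k → B * suc P ≡ (1 + P * (r * P)) * m →
      suc P * (K * (P + m) + k * B) ≡ P * P * (K + k * m * r) + P * (K * suc m + m)
    combine K k m r B _ refl B*[1+P]≡ = trans (regroup K k m B (K + k))
      (trans (cong (λ z → K * (K + k + m) * suc (K + k) + k * z) B*[1+P]≡) (expand K k m r))
      where
      regroup : ∀ K k m B P → suc P * (K * (P + m) + k * B) ≡ K * (P + m) * suc P + k * (B * suc P)
      regroup = ℕ-Solver.solve-∀
      expand : ∀ K k m r → K * (K + k + m) * suc (K + k) + k * ((1 + (K + k) * (r * (K + k))) * m)
                         ≡ (K + k) * (K + k) * (K + k * m * r) + (K + k) * (K * suc m + m)
      expand = ℕ-Solver.solve-∀
    combo≡ : binomCombo (suc m) 1 k ≡ K * (p + m) + k * B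
    combo≡ = trans (cong₂ (λ a b → a * ((q + suc m) C 1) + k * b) (m∸[m∸n]≡n K≤q) (cong₂ _C_ (+-suc q m) (+-comm p 1)))
                   (cong (λ x → K * x + k * B) (trans (nC1≡n (q + suc m)) (+-suc q m)))
    [1+p]*combo≡ : suc p * binomCombo (suc m) 1 k ≡ p * p * (K + k * m * r) + p * (K * suc m + m)
    [1+p]*combo≡ = trans (cong (suc p *_) combo≡) (combine K k m r B p p≡K+k B*[1+p]≡)
    p²∣ : p ^ 2 ∣ p * p * (K + k * m * r) + p * (K * suc m + m)
    p²∣ = ∣m∣n⇒∣m+n (subst (_∣ p * p * (K + k * m * r)) (cong (p *_) (sym (*-identityʳ p))) (∣m⇒∣m*n _ ∣-refl))
                    (p^2∣p*x p∣K[1+m]+m)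

  p²-Witness : ℕ → Set
  p²-Witness u = ∃₂ λ j k → j ≤ q × 1 ≤ k × k ≤ q ×
    ((n″ s : ℕ) → 1 ≤ s → p ^ 2 ∣ ∣ altSum p u (n″ * p ^ (s + 1) + k * p ^ s + j) ∣)

  witness[j=0] : ∀ {m t} → suc m ≤ q → (p + m) C p ≡ 1 + p * t →
    Σ[ k′ ∈ ℕ ] suc k′ ≤ q × p ∣ suc k′ * t + 1 → p²-Witness (suc m)
  witness[j=0] u≤q [p+m]Cp≡ (k′ , k≤q , p∣kt+1) =
    0 , suc k′ , z≤n , s≤s z≤n , k≤q ,
    p²∣binomCombo⇒p²∣altSum u≤q z≤n k≤q (p²∣binomCombo[j=0] k≤q [p+m]Cp≡ p∣kt+1)

  witness[j=1] : ∀ {m r} → suc m ≤ q → (p + m) C p ≡ 1 + p * (r * p) →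
    Σ[ K′ ∈ ℕ ] suc K′ ≤ q × p ∣ suc K′ * suc m + m → p²-Witness (suc m)
  witness[j=1] {r = r} u≤q [p+m]Cp≡ (K′ , K≤q , p∣K[1+m]+m) =
    1 , suc (q ∸ suc K′) , q≥1 , s≤s z≤n , k≤q ,
    p²∣binomCombo⇒p²∣altSum u≤q q≥1 k≤q (p²∣binomCombo[j=1] {r = r} K≤q [p+m]Cp≡ p∣K[1+m]+m)
    where
    k≤q : suc (q ∸ suc K′) ≤ q
    k≤q = ∸-monoʳ-< (s≤s z≤n) K≤q

  p²∣altSum-witness : (u : ℕ) → 2 ≤ u → u ≤ q → p²-Witness u
  p²∣altSum-witness (suc m) (s≤s m≥1) u≤q with [p+m]Cp≡1+p*t {m} (m<n⇒m<1+n u≤q)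
  ... | t , [p+m]Cp≡ with p ∣? t
  ...   | no p∤t             = witness[j=0] u≤q [p+m]Cp≡ (inverse {t} {1} p∤t p∤1)
  ...   | yes (divides r refl) =
    witness[j=1] {r = r} u≤q [p+m]Cp≡ (inverse {suc m} {m} (0<m<p⇒p∤m (s≤s z≤n) (s≤s u≤q)) (0<m<p⇒p∤m m≥1 (m<n⇒m<1+n u≤q)))

lemma2p3 : (p : ℕ) → Prime p → 3 ≤ p →
    -- main statement
    ((u : ℕ) → 1 ≤ u → u ≤ p ∸ 1 →
     (n n″ k s j : ℕ) → 1 ≤ k → k ≤ p ∸ 1 → 1 ≤ s → j ≤ p ∸ 1 →
     p ≤ n → n ≡ n″ * p ^ (s + 1) + k * p ^ s + j →
     (v : ℕ) → IsVal p ∣ altSum p u n ∣ v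
               ⇔ IsVal p ((p ∸ k) * ((p + u ∸ 1) C j) + k * ((p + u ∸ 1) C (p + j))) v)
  × -- (a)
    ((n : ℕ) → 1 ≤ n → IsVal p ∣ altSum p 1 n ∣ 1)
  × -- (b)
    ((u : ℕ) → 1 ≤ u → u ≤ p ∸ 1 →
     (n n″ k s j : ℕ) → 1 ≤ k → k ≤ p ∸ 1 → 1 ≤ s → j ≤ p ∸ 1 →
     p ≤ n → n ≡ n″ * p ^ (s + 1) + k * p ^ s + j →
     u ≤ j → IsVal p ∣ altSum p u n ∣ 1)
  × -- (c)
    ((u : ℕ) → 2 ≤ u → u ≤ p ∸ 1 →
     ∃₂ λ j k → j ≤ p ∸ 1 × 1 ≤ k × k ≤ p ∸ 1 ×
       ((n″ s : ℕ) → 1 ≤ s →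
        p ^ 2 ∣ ∣ altSum p u (n″ * p ^ (s + 1) + k * p ^ s + j) ∣))
lemma2p3 (suc q) isPrime (s≤s q≥2) =
  valuation-altSum , altSum₁-valuation , valuation-altSum-u≤j , p²∣altSum-witness
  where open OddPrime q isPrime q≥2
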